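{- Let $G$ be a graph with girth $g\ge 6$ and maximum degree $\Delta\ge 3$. Then $\mu_2(G)\le 1+\Delta(\Delta-1)$.
   Context: All graphs are finite, simple, undirected and connected. The girth is the length of a shortest cycle. For a graph $G$, a set $S\subseteq V(G)$ and an integer $k\ge 1$, two vertices $x,y$ are $S_k$-visible if there is a shortest $x,y$-path of length at most $k$ none of whose internal vertices lies in $S$. $S$ is a $k$-distance mutual-visibility set if every two vertices of $S$ are $S_k$-visible, and $\mu_k(G)$ is the maximum cardinality of such a set. -}

module Defs where

open import Data.Nat using (ℕ; zero; suc; _+_; _≤_; _<_)
open import Data.Fin using (Fin)
open import Data.Fin.Subset using (Subset; _∈_; _∉_)
open import Data.Bool using (Bool; true; false; T; if_then_else_)
open import Data.List using (List; []; _∷_; map; allFin)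
open import Data.Nat.ListAction using (sum)
open import Data.List.Relation.Unary.All using (All)
open import Data.List.Relation.Unary.Unique.Propositional using (Unique)
open import Data.Product using (Σ; ∃; _×_; _,_)
open import Relation.Binary.PropositionalEquality using (_≡_)
open import Relation.Nullary using (¬_)

record Graph : Set where
  field
    n     : ℕ
    adj   : Fin n → Fin n → Bool
    sym   : ∀ x y → adj x y ≡ adj y x
    irrefl : ∀ x → adj x x ≡ false

module _ (G : Graph) where
  open Graph G

  Adj : Fin n → Fin n → Set
  Adj x y = T (adj x y)

  data Walk : Fin n → Fin n → Set where
    [_]  : ∀ x → Walk x x
    _∷_  : ∀ {x y z} → Adj x y → Walk y z → Walk x z

  length : ∀ {x y} → Walk x y → ℕ
  length [ _ ]   = 0
  length (_ ∷ w) = suc (length w)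

  initVerts : ∀ {x y} → Walk x y → List (Fin n)
  initVerts [ _ ]             = []
  initVerts (_∷_ {x} _ w)     = x ∷ initVerts w

  interior : ∀ {x y} → Walk x y → List (Fin n)
  interior [ _ ]   = []
  interior (_ ∷ w) = initVerts w

  Connected : Set
  Connected = ∀ x y → Walk x y

  degree : Fin n → ℕ
  degree v = sum (map (λ u → if adj v u then 1 else 0) (allFin n))

  MaxDegree : ℕ → Set
  MaxDegree Δ = (∀ v → degree v ≤ Δ) × (∃ λ v → degree v ≡ Δ)

  IsCycle : ∀ {x} → Walk x x → Set
  IsCycle w = (3 ≤ length w) × Unique (initVerts w)

  -- girth ≥ g : every cycle has length at least g (acyclic graphs have
  -- infinite girth and satisfy this for every g)
  GirthAtLeast : ℕ → Set
  GirthAtLeast g = ∀ x (w : Walk x x) → IsCycle w → g ≤ length w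

  Shortest : ∀ {x y} → Walk x y → Set
  Shortest {x} {y} w = ∀ (w' : Walk x y) → length w ≤ length w'

  Visible : ℕ → Subset n → Fin n → Fin n → Set
  Visible k S x y =
    Σ (Walk x y) λ w → Shortest w × length w ≤ k × All (_∉ S) (interior w)

  IsKDistMutualVis : ℕ → Subset n → Set
  IsKDistMutualVis k S = ∀ x y → x ∈ S → y ∈ S → Visible k S x y

-- Fix x ∈ S. Every other v ∈ S is joined to x by a path of length at most 2
-- with no internal vertex in S, so v is a neighbour u of x, or a neighbour
-- (other than x) of a neighbour u ∉ S of x. Charging v to u, a neighbour in S
-- is charged once and a neighbour outside S at most Δ − 1 times, whence
-- |S| ≤ 1 + Δ · max(1, Δ − 1) = 1 + Δ(Δ − 1) once Δ ≥ 2.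
module Submission where

open import Defs
open import Data.Nat using (ℕ; zero; suc; _≤_; _+_; _*_; _∸_; z≤n; s≤s)
open import Data.Nat.Properties
  using ( ≤-reflexive; ≤-trans; n≤1+n; m≤m+n; m≤n+m; +-mono-≤; +-monoʳ-≤
        ; *-monoʳ-≤; *-monoˡ-≤; ∸-monoˡ-≤; +-commutativeSemigroup; +-*-semiring
        ; module ≤-Reasoning )
open import Data.Nat.ListAction as List using ()
open import Data.Fin using (Fin; zero; suc; _≟_)
open import Data.Fin.Subset using (Subset; ∣_∣; _∈_; _∉_)
open import Data.Fin.Subset.Properties using (_∈?_; nonempty?; Empty-unique; ∣⊥∣≡0)
open import Data.Bool using (Bool; true; false; if_then_else_)
open import Data.Bool.Properties using (T-≡)
open import Data.Vec using ([]; _∷_)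
open import Data.List using (map; allFin; tabulate)
open import Data.List.Properties using (map-tabulate)
open import Data.List.Relation.Unary.All using (_∷_)
open import Data.Product using (∃-syntax; _×_; _,_)
open import Function using (_∘_; id; case_of_)
open import Function.Bundles using (Equivalence)
open import Relation.Binary.PropositionalEquality
open import Relation.Nullary using (Dec; does; yes; no; contradiction)
open import Relation.Nullary.Decidable using (dec-true; dec-false)
open import Algebra.Properties.CommutativeSemigroup +-commutativeSemigroup using (x∙yz≈y∙xz)
open import Algebra.Properties.Semiring.Sum +-*-semiring
  using (sum; sum-cong-≗; sum-replicate-zero; ∑-distrib-+; ∑-comm; *-distribˡ-sum; *-distribʳ-sum)

𝟙 : Bool → ℕ
𝟙 b = if b then 1 else 0

𝟙[_] : ∀ {a} {A : Set a} → Dec A → ℕ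
𝟙[ a? ] = 𝟙 (does a?)

∑-mono-≤ : ∀ {n} {f g : Fin n → ℕ} → (∀ i → f i ≤ g i) → sum f ≤ sum g
∑-mono-≤ {zero}  f≤g = z≤n
∑-mono-≤ {suc n} f≤g = +-mono-≤ (f≤g zero) (∑-mono-≤ (f≤g ∘ suc))

term≤∑ : ∀ {n} (f : Fin n → ℕ) i → f i ≤ sum f
term≤∑ f zero    = m≤m+n _ _
term≤∑ f (suc i) = ≤-trans (term≤∑ (f ∘ suc) i) (m≤n+m _ (f zero))

𝟙*-mono-≤ : ∀ {m n} b → (b ≡ true → m ≤ n) → 𝟙 b * m ≤ 𝟙 b * n
𝟙*-mono-≤ true  m≤n = *-monoʳ-≤ 1 (m≤n refl)
𝟙*-mono-≤ false _   = z≤n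

∑-δ : ∀ {n} (i : Fin n) → sum (λ j → 𝟙[ i ≟ j ]) ≡ 1
∑-δ {suc n} zero    = cong suc (sum-replicate-zero n)
∑-δ         (suc i) = ∑-δ i

_except_ : ∀ {n} → (Fin n → ℕ) → Fin n → Fin n → ℕ
(f except i) j = if does (i ≟ j) then 0 else f j

∑-except : ∀ {n} (f : Fin n → ℕ) i → f i + sum (f except i) ≡ sum f
∑-except f zero    = refl
∑-except f (suc i) = begin
  f (suc i) + (f zero + sum ((f ∘ suc) except i)) ≡⟨ x∙yz≈y∙xz (f (suc i)) (f zero) _ ⟩
  f zero + (f (suc i) + sum ((f ∘ suc) except i)) ≡⟨ cong (f zero +_) (∑-except (f ∘ suc) i) ⟩
  f zero + sum (f ∘ suc)                          ∎
  where open ≡-Reasoning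

sum-tabulate : ∀ {n} (f : Fin n → ℕ) → List.sum (tabulate f) ≡ sum f
sum-tabulate {zero}  f = refl
sum-tabulate {suc n} f = cong (f zero +_) (sum-tabulate (f ∘ suc))

sum-map-allFin : ∀ {n} (f : Fin n → ℕ) → List.sum (map f (allFin n)) ≡ sum f
sum-map-allFin f = trans (cong List.sum (map-tabulate id f)) (sum-tabulate f)

∣p∣≡∑𝟙[∈] : ∀ {n} (p : Subset n) → ∣ p ∣ ≡ sum (λ i → 𝟙[ i ∈? p ])
∣p∣≡∑𝟙[∈] []          = refl
∣p∣≡∑𝟙[∈] (true  ∷ p) = cong suc (∣p∣≡∑𝟙[∈] p)
∣p∣≡∑𝟙[∈] (false ∷ p) = ∣p∣≡∑𝟙[∈] p

module _ (G : Graph) where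
  open Graph G using (n; adj)

  degree≡∑ : ∀ v → degree G v ≡ sum (𝟙 ∘ adj v)
  degree≡∑ v = sum-map-allFin (𝟙 ∘ adj v)

  Adj⇒adj≡true : ∀ {u v} → Adj G u v → adj u v ≡ true
  Adj⇒adj≡true = Equivalence.to T-≡

  module SeenFrom (S : Subset n) (x : Fin n) where

    -- The vertices v charged to u. A vertex u ∈ S blocks every path through
    -- it, so only u itself is seen from x through u; otherwise every
    -- neighbour of u other than x may be.
    seenVia : Fin n → Fin n → ℕ
    seenVia u v = if does (u ∈? S) then 𝟙[ u ≟ v ] else ((𝟙 ∘ adj u) except x) v

    seenViaNeighbour : Fin n → Fin n → ℕ
    seenViaNeighbour u v = 𝟙 (adj x u) * seenVia u v

    ∑seenVia≤Δ∸1 : ∀ {Δ} → (∀ v → degree G v ≤ Δ) → 2 ≤ Δ →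
                   ∀ u → adj x u ≡ true → sum (seenVia u) ≤ Δ ∸ 1
    ∑seenVia≤Δ∸1 {Δ} deg≤Δ 2≤Δ u x~u with u ∈? S
    ... | yes _ = ≤-trans (≤-reflexive (∑-δ u)) (∸-monoˡ-≤ 1 2≤Δ)
    ... | no  _ = ∸-monoˡ-≤ 1 (begin
      1 + others                ≡⟨ cong (λ b → 𝟙 b + others) u~x ⟨
      𝟙 (adj u x) + others      ≡⟨ ∑-except (𝟙 ∘ adj u) x ⟩
      sum (𝟙 ∘ adj u)           ≡⟨ degree≡∑ u ⟨
      degree G u                ≤⟨ deg≤Δ u ⟩
      Δ                         ∎)
      where
      open ≤-Reasoning
      others : ℕ
      others = sum ((𝟙 ∘ adj u) except x)
      u~x : adj u x ≡ true
      u~x = trans (Graph.sym G u x) x~u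

    seenVia-self : ∀ {v} → v ∈ S → seenVia v v ≡ 1
    seenVia-self {v} v∈S rewrite dec-true (v ∈? S) v∈S | dec-true (v ≟ v) refl = refl

    seenVia-beyond : ∀ {u v} → u ∉ S → x ≢ v → adj u v ≡ true → seenVia u v ≡ 1
    seenVia-beyond {u} {v} u∉S x≢v u~v
      rewrite dec-false (u ∈? S) u∉S | dec-false (x ≟ v) x≢v | u~v = refl

    visible⇒seen : ∀ {v} → v ∈ S → x ≢ v → Visible G 2 S x v →
                   ∃[ u ] adj x u ≡ true × seenVia u v ≡ 1
    visible⇒seen v∈S x≢v ([ _ ] , _) =
      contradiction refl x≢v
    visible⇒seen {v} v∈S x≢v (x~v ∷ [ _ ] , _) =
      v , Adj⇒adj≡true x~v , seenVia-self v∈S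
    visible⇒seen v∈S x≢v (_∷_ {y = u} x~u (u~v ∷ [ _ ]) , _ , _ , u∉S ∷ _) =
      u , Adj⇒adj≡true x~u , seenVia-beyond u∉S x≢v (Adj⇒adj≡true u~v)
    visible⇒seen _ _ (_ ∷ _ ∷ _ ∷ _ , _ , s≤s (s≤s ()) , _)

    seen⇒1≤∑ : ∀ {v} → ∃[ u ] adj x u ≡ true × seenVia u v ≡ 1 →
               1 ≤ sum (λ u → seenViaNeighbour u v)
    seen⇒1≤∑ {v} (u , x~u , seenVia≡1) = ≤-trans (≤-reflexive 1≡term) (term≤∑ _ u)
      where
      1≡term : 1 ≡ seenViaNeighbour u v
      1≡term = cong₂ (λ b s → 𝟙 b * s) (sym x~u) (sym seenVia≡1)

    S-covered : x ∈ S → IsKDistMutualVis G 2 S →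
                ∀ v → 𝟙[ v ∈? S ] ≤ 𝟙[ x ≟ v ] + sum (λ u → seenViaNeighbour u v)
    S-covered x∈S vis v with v ∈? S
    ... | no _    = z≤n
    ... | yes v∈S = case x ≟ v of λ where
      (yes x≡v) → ≤-trans (≤-reflexive (cong 𝟙 (sym (dec-true (x ≟ v) x≡v)))) (m≤m+n _ _)
      (no x≢v)  → ≤-trans (seen⇒1≤∑ (visible⇒seen v∈S x≢v (vis x v x∈S v∈S))) (m≤n+m _ _)

    ∣S∣≤1+Δ[Δ∸1] : ∀ {Δ} → (∀ v → degree G v ≤ Δ) → 2 ≤ Δ →
                   x ∈ S → IsKDistMutualVis G 2 S → ∣ S ∣ ≤ 1 + Δ * (Δ ∸ 1)
    ∣S∣≤1+Δ[Δ∸1] {Δ} deg≤Δ 2≤Δ x∈S vis = begin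
      ∣ S ∣
        ≡⟨ ∣p∣≡∑𝟙[∈] S ⟩
      sum (λ v → 𝟙[ v ∈? S ])
        ≤⟨ ∑-mono-≤ (S-covered x∈S vis) ⟩
      sum (λ v → 𝟙[ x ≟ v ] + sum (λ u → seenViaNeighbour u v))
        ≡⟨ ∑-distrib-+ (λ v → 𝟙[ x ≟ v ]) (λ v → sum (λ u → seenViaNeighbour u v)) ⟩
      sum (λ v → 𝟙[ x ≟ v ]) + sum (λ v → sum (λ u → seenViaNeighbour u v))
        ≡⟨ cong₂ _+_ (∑-δ x) (∑-comm (λ v u → seenViaNeighbour u v)) ⟩
      1 + sum (λ u → sum (seenViaNeighbour u))
        ≡⟨ cong (1 +_) (sum-cong-≗ λ u → *-distribˡ-sum (𝟙 (adj x u)) (seenVia u)) ⟨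
      1 + sum (λ u → 𝟙 (adj x u) * sum (seenVia u))
        ≤⟨ +-monoʳ-≤ 1 (∑-mono-≤ λ u → 𝟙*-mono-≤ (adj x u) (∑seenVia≤Δ∸1 deg≤Δ 2≤Δ u)) ⟩
      1 + sum (λ u → 𝟙 (adj x u) * (Δ ∸ 1))
        ≡⟨ cong (1 +_) (*-distribʳ-sum (Δ ∸ 1) (𝟙 ∘ adj x)) ⟨
      1 + sum (𝟙 ∘ adj x) * (Δ ∸ 1)
        ≡⟨ cong (λ d → 1 + d * (Δ ∸ 1)) (degree≡∑ x) ⟨
      1 + degree G x * (Δ ∸ 1)
        ≤⟨ +-monoʳ-≤ 1 (*-monoˡ-≤ (Δ ∸ 1) (deg≤Δ x)) ⟩
      1 + Δ * (Δ ∸ 1)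
        ∎
      where open ≤-Reasoning

  ∣mutualVis₂∣≤1+Δ[Δ∸1] : ∀ {Δ} → (∀ v → degree G v ≤ Δ) → 2 ≤ Δ →
                          ∀ S → IsKDistMutualVis G 2 S → ∣ S ∣ ≤ 1 + Δ * (Δ ∸ 1)
  ∣mutualVis₂∣≤1+Δ[Δ∸1] deg≤Δ 2≤Δ S vis with nonempty? S
  ... | yes (x , x∈S) = SeenFrom.∣S∣≤1+Δ[Δ∸1] S x deg≤Δ 2≤Δ x∈S vis
  ... | no  S-empty   rewrite Empty-unique S-empty | ∣⊥∣≡0 n = z≤n

theorem5p2 : (G : Graph) → Connected G → (Δ : ℕ) → MaxDegree G Δ → 3 ≤ Δ →
    GirthAtLeast G 6 →
    ∀ S → IsKDistMutualVis G 2 S → ∣ S ∣ ≤ 1 + Δ * (Δ ∸ 1)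
theorem5p2 G _ Δ (deg≤Δ , _) 3≤Δ _ =
  ∣mutualVis₂∣≤1+Δ[Δ∸1] G deg≤Δ (≤-trans (n≤1+n 2) 3≤Δ)
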